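{- For a graph $G$, the following are equivalent: (1) $G$ is a caterpillar forest; (2) $G$ is repeating; (3) $G$ is $6$-repeating.
   Context: For $q\in\mathbb{N}$, a closed walk $(v_0,v_1,\dots,v_r=v_0)$ is $q$-repeating if there exist $0\le t<t'\le r-1$ with $t\equiv t'\pmod q$ and $v_t=v_{t'}$. A graph is $q$-repeating if for every integer $j\ge2$, every closed walk on it of length $jq$ (number of edges, counted with repetition) is $q$-repeating; it is repeating if it is $q$-repeating for every even $q\in\mathbb{N}$. A caterpillar is a tree which becomes a path on removal of its leaves; a caterpillar forest is a forest each of whose components is a caterpillar. -}

module Defs where

open import Data.Nat using (ℕ; zero; suc; _+_; _*_; _∸_; _<_; _≤_)
open import Data.Nat.Divisibility using (_∣_)
open import Data.Bool using (Bool; true; false)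
open import Data.Fin using (Fin; toℕ)
open import Data.Fin.Subset using (∣_∣)
open import Data.Vec using (tabulate)
open import Data.Product using (Σ; ∃; ∃-syntax; _×_; _,_)
open import Data.Sum using (_⊎_)
open import Data.Empty using (⊥)
open import Relation.Nullary using (¬_)
open import Relation.Binary.PropositionalEquality using (_≡_; _≢_)
open import Function.Bundles using (_⇔_)
open import Function.Definitions using (Injective)

record Graph (n : ℕ) : Set where
  field
    adj   : Fin n → Fin n → Bool
    sym   : ∀ u v → adj u v ≡ adj v u
    irrefl : ∀ v → adj v v ≡ false
open Graph public

Adj : ∀ {n} → Graph n → Fin n → Fin n → Set
Adj G u v = adj G u v ≡ true

-- A walk of length r: the vertices v 0, …, v r (values beyond r are irrelevant).
IsWalk : ∀ {n} → Graph n → ℕ → (ℕ → Fin n) → Set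
IsWalk G r v = ∀ i → i < r → Adj G (v i) (v (suc i))

IsClosedWalk : ∀ {n} → Graph n → ℕ → (ℕ → Fin n) → Set
IsClosedWalk G r v = IsWalk G r v × (v r ≡ v 0)

QRepeatingWalk : ∀ {n} → ℕ → ℕ → (ℕ → Fin n) → Set
QRepeatingWalk q r v =
  ∃[ t ] ∃[ t' ] (t < t') × (suc t' ≤ r) × (q ∣ (t' ∸ t)) × (v t ≡ v t')

QRepeating : ∀ {n} → Graph n → ℕ → Set
QRepeating G q = ∀ j → 2 ≤ j → ∀ v → IsClosedWalk G (j * q) v → QRepeatingWalk q (j * q) v

-- G is repeating: q-repeating for every even q ∈ ℕ = {1,2,…}, i.e. q = 2(m+1).
Repeating : ∀ {n} → Graph n → Set
Repeating G = ∀ m → QRepeating G (2 * suc m)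

HasCycle : ∀ {n} → Graph n → Set
HasCycle {n} G =
  ∃[ k ] ∃[ c ] (3 ≤ k) × IsClosedWalk G k c
    × (∀ i j → i < k → j < k → c i ≡ c j → i ≡ j)

Forest : ∀ {n} → Graph n → Set
Forest G = ¬ HasCycle G

Connected : ∀ {n} → Graph n → Fin n → Fin n → Set
Connected G x y = ∃[ r ] ∃[ v ] IsWalk G r v × (v 0 ≡ x) × (v r ≡ y)

degree : ∀ {n} → Graph n → Fin n → ℕ
degree G v = ∣ tabulate (adj G v) ∣

Leaf : ∀ {n} → Graph n → Fin n → Set
Leaf G v = degree G v ≡ 1

InducesPath : ∀ {n} → Graph n → (Fin n → Set) → Set
InducesPath {n} G S =
  ∃[ m ] Σ (Fin m → Fin n) λ u →
    Injective _≡_ _≡_ u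
    × (∀ y → S y ⇔ (∃[ i ] u i ≡ y))
    × (∀ i j → Adj G (u i) (u j) ⇔ ((toℕ j ≡ suc (toℕ i)) ⊎ (toℕ i ≡ suc (toℕ j))))

-- Caterpillar forest: a forest each of whose components becomes a path
-- (possibly empty) on removal of its leaves.
CaterpillarForest : ∀ {n} → Graph n → Set
CaterpillarForest G =
  Forest G × (∀ x → InducesPath G (λ y → Connected G x y × ¬ Leaf G y))

-- A closed walk v of length 12 with v t ≢ v (t + 6) for all t < 6 is not 6-repeating. Such walks
-- exist around a triangle, around a hexagon and around a vertex with three non-leaf neighbours, and
-- going lcm(6, k) steps around a k-cycle with k ∤ 6 is not 6-repeating either. So a 6-repeating graph
-- is a forest in which a non-leaf has at most two non-leaf neighbours: a maximal path of non-leaves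
-- picks up every non-leaf of its component.
--
-- Conversely, let v be a closed walk of length j q, q even, on a caterpillar forest. If it steps from
-- a leaf to a leaf it bounces on that edge. Otherwise project it to the spine, a leaf going to its
-- neighbour: the projection P moves by at most one per step, and the side of v t in the bipartition
-- alternates. At a maximum of P the walk shifted by q is not above P and a period later it is not
-- below; by parity it cannot jump across, so at some t the walk and its shift have the same position
-- and the same side, whence v repeats at t or t + 1.

module Submission where

open import Defs hiding (sym)
open import Data.Nat using (ℕ; zero; suc; _+_; _*_; _∸_; _≤_; _<_; z≤n; s≤s; NonZero; >-nonZero; _%_; _/_; _<?_; _≤?_; parity)
open import Data.Nat.Properties
open import Data.Nat.DivMod using (m≡m%n+[m/n]*n; [m+n]%n≡m%n; m%n<n; m%n%n≡m%n; n%n≡0; m≤n⇒m%n≡m; m<n⇒m%n≡m; %-distribˡ-+)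
open import Data.Nat.Divisibility using (_∣_; divides; _∣?_; ∣⇒≤; n∣m⇒m%n≡0)
open import Data.Nat.GCD using (gcd)
open import Data.Nat.LCM using (lcm; lcm-least; m∣lcm[m,n]; n∣lcm[m,n]; gcd*lcm)
open import Data.Bool using (Bool; true; false)
open import Data.Parity.Base using (Parity; _⁻¹)
open import Data.Parity.Properties using (⁻¹-involutive; p≢p⁻¹; suc-homo-⁻¹)
open import Data.Bool.Properties using () renaming (_≟_ to _≟ᵇ_)
open import Data.Fin using (Fin; toℕ; fromℕ<) renaming (_≟_ to _≟ᶠ_; _<_ to _<ᶠ_)
open import Data.Fin.Properties using (any?; pigeonhole; toℕ<n; toℕ-injective; toℕ-fromℕ<)
open import Data.Fin.Subset using (Subset; ∣_∣; _∈_; _⊆_; ⁅_⁆; _-_; Nonempty)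
open import Data.Fin.Subset.Properties
  using (_∈?_; nonempty?; Empty-unique; ∣⊥∣≡0; x∈⁅x⁆; x∈⁅y⁆⇒x≡y; ∣⁅x⁆∣≡1; p⊆q⇒∣p∣≤∣q∣; x∈p∧x≢y⇒x∈p-y; x∈p⇒∣p-x∣<∣p∣)
open import Data.Vec using (tabulate)
open import Data.Vec.Properties using (lookup∘tabulate; lookup⇒[]=; []=⇒lookup)
open import Data.List using (List; []; _∷_; length; head; drop; upTo)
open import Data.List.Extrema.Nat using (argmax; f[xs]≤f[argmax])
open import Data.List.Membership.Propositional.Properties using (∈-upTo⁺)
import Data.List.Relation.Unary.All as All
open import Data.List.Relation.Unary.Linked using (Linked; [-]; _∷_)
open import Data.Maybe using (fromMaybe)
open import Data.Product using (Σ; ∃; ∃₂; ∃-syntax; _×_; _,_; proj₁; proj₂)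
open import Data.Sum using (_⊎_; inj₁; inj₂; [_,_]′)
open import Data.Empty using (⊥; ⊥-elim)
open import Relation.Nullary using (¬_; Dec; yes; no; contradiction)
open import Relation.Nullary.Decidable using (map′; True; toWitness; _×-dec_; ¬?; decidable-stable)
open import Relation.Binary.Definitions using (tri<; tri≈; tri>)
open import Relation.Binary.PropositionalEquality
open import Function using (_∘′_)
open import Function.Bundles using (_⇔_; mk⇔; Equivalence)

module _ {n : ℕ} where

  x∈p⇒0<∣p∣ : ∀ {p : Subset n} {x} → x ∈ p → 0 < ∣ p ∣
  x∈p⇒0<∣p∣ {p} {x} x∈p = subst (_≤ _) (∣⁅x⁆∣≡1 x) (p⊆q⇒∣p∣≤∣q∣ ⁅x⁆⊆p)
    where
      ⁅x⁆⊆p : ⁅ x ⁆ ⊆ p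
      ⁅x⁆⊆p y∈⁅x⁆ = subst (_∈ p) (sym (x∈⁅y⁆⇒x≡y x y∈⁅x⁆)) x∈p

  ∣p∣≡1⇒x≡y : ∀ {p : Subset n} → ∣ p ∣ ≡ 1 → ∀ {x y} → x ∈ p → y ∈ p → x ≡ y
  ∣p∣≡1⇒x≡y {p} ∣p∣≡1 {x} {y} x∈p y∈p with x ≟ᶠ y
  ... | yes x≡y = x≡y
  ... | no x≢y = contradiction (≤-trans 0<∣p-x∣ (≤-pred ∣p-x∣<1)) λ ()
    where
      0<∣p-x∣ : 0 < ∣ p - x ∣
      0<∣p-x∣ = x∈p⇒0<∣p∣ (x∈p∧x≢y⇒x∈p-y y∈p (x≢y ∘′ sym))
      ∣p-x∣<1 : ∣ p - x ∣ < 1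
      ∣p-x∣<1 = subst (∣ p - x ∣ <_) ∣p∣≡1 (x∈p⇒∣p-x∣<∣p∣ x∈p)

  ∣p∣≡1⇒nonempty : ∀ {p : Subset n} → ∣ p ∣ ≡ 1 → Nonempty p
  ∣p∣≡1⇒nonempty {p} ∣p∣≡1 with nonempty? p
  ... | yes ne = ne
  ... | no ¬ne = contradiction (trans (sym (∣⊥∣≡0 n)) (trans (cong ∣_∣ (sym (Empty-unique ¬ne))) ∣p∣≡1)) λ ()

  x∈p∧∣p∣≢1⇒∃y≢x : ∀ {p : Subset n} {x} → x ∈ p → ∣ p ∣ ≢ 1 → ∃[ y ] y ≢ x × y ∈ p
  x∈p∧∣p∣≢1⇒∃y≢x {p} {x} x∈p ∣p∣≢1 with any? (λ y → ¬? (y ≟ᶠ x) ×-dec y ∈? p)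
  ... | yes y = y
  ... | no ∄y = contradiction (≤-antisym ∣p∣≤1 (x∈p⇒0<∣p∣ x∈p)) ∣p∣≢1
    where
      p⊆⁅x⁆ : p ⊆ ⁅ x ⁆
      p⊆⁅x⁆ {y} y∈p = subst (_∈ ⁅ x ⁆) (sym (decidable-stable (y ≟ᶠ x) λ y≢x → ∄y (y , y≢x , y∈p))) (x∈⁅x⁆ x)
      ∣p∣≤1 : ∣ p ∣ ≤ 1
      ∣p∣≤1 = subst (∣ p ∣ ≤_) (∣⁅x⁆∣≡1 x) (p⊆q⇒∣p∣≤∣q∣ p⊆⁅x⁆)

[m+n]%o≡[m%o+n]%o : ∀ m n o .{{_ : NonZero o}} → (m + n) % o ≡ (m % o + n) % o
[m+n]%o≡[m%o+n]%o m n o = begin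
  (m + n) % o             ≡⟨ %-distribˡ-+ m n o ⟩
  (m % o + n % o) % o     ≡⟨ cong (λ k → (k + n % o) % o) (m%n%n≡m%n m o) ⟨
  (m % o % o + n % o) % o ≡⟨ %-distribˡ-+ (m % o) n o ⟨
  (m % o + n) % o         ∎
  where open ≡-Reasoning

suc-%-suc : ∀ t r .{{_ : NonZero r}} → suc t % r ≡ suc (t % r) % r
suc-%-suc t r = trans (cong (_% r) (+-comm 1 t)) (trans ([m+n]%o≡[m%o+n]%o t 1 r) (cong (_% r) (+-comm (t % r) 1)))

%-≡⇒∣∸ : ∀ t t′ k .{{_ : NonZero k}} → t % k ≡ t′ % k → k ∣ t′ ∸ t
%-≡⇒∣∸ t t′ k t%k≡t′%k = divides (t′ / k ∸ t / k) (begin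
    t′ ∸ t                                          ≡⟨ cong₂ _∸_ (m≡m%n+[m/n]*n t′ k) (m≡m%n+[m/n]*n t k) ⟩
    (t′ % k + (t′ / k) * k) ∸ (t % k + (t / k) * k)  ≡⟨ cong (λ s → (t′ % k + (t′ / k) * k) ∸ (s + (t / k) * k)) t%k≡t′%k ⟩
    (t′ % k + (t′ / k) * k) ∸ (t′ % k + (t / k) * k) ≡⟨ [m+n]∸[m+o]≡n∸o (t′ % k) _ _ ⟩
    (t′ / k) * k ∸ (t / k) * k                      ≡⟨ *-distribʳ-∸ k (t′ / k) (t / k) ⟨
    (t′ / k ∸ t / k) * k                            ∎)
  where open ≡-Reasoning

lcm-suc≢0 : ∀ m n → lcm (suc m) (suc n) ≢ 0
lcm-suc≢0 m n lcm≡0 = contradiction (begin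
    0                                 ≡⟨ *-zeroʳ (gcd (suc m) (suc n)) ⟨
    gcd (suc m) (suc n) * 0           ≡⟨ cong (gcd (suc m) (suc n) *_) lcm≡0 ⟨
    gcd (suc m) (suc n) * lcm (suc m) (suc n) ≡⟨ gcd*lcm (suc m) (suc n) ⟩
    suc m * suc n                     ∎) λ ()
  where open ≡-Reasoning

3≤∣6⇒3∨6 : ∀ {k} → 3 ≤ k → k ∣ 6 → k ≡ 3 ⊎ k ≡ 6
3≤∣6⇒3∨6 {k} 3≤k k∣6 = go k 3≤k (∣⇒≤ k∣6) k∣6
  where
    go : ∀ k → 3 ≤ k → k ≤ 6 → k ∣ 6 → k ≡ 3 ⊎ k ≡ 6
    go 0 () _ _
    go 1 (s≤s ()) _ _
    go 2 (s≤s (s≤s ())) _ _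
    go 3 _ _ _ = inj₁ refl
    go 4 _ _ (divides 0 ())
    go 4 _ _ (divides 1 ())
    go 4 _ _ (divides (suc (suc _)) ())
    go 5 _ _ (divides 0 ())
    go 5 _ _ (divides 1 ())
    go 5 _ _ (divides (suc (suc _)) ())
    go 6 _ _ _ = inj₂ refl
    go (suc (suc (suc (suc (suc (suc (suc _))))))) _ (s≤s (s≤s (s≤s (s≤s (s≤s (s≤s ())))))) _

+-2*-suc : ∀ t s → t + 2 * suc s ≡ suc (suc (t + 2 * s))
+-2*-suc t s = trans (cong (t +_) (*-suc 2 s)) (trans (+-suc t _) (cong suc (+-suc t _)))

discrete-IVT : ∀ (f g : ℕ → ℕ) → (∀ t → g t < f t → g (suc t) ≤ f (suc t)) →
               ∀ a d → g a ≤ f a → f (a + d) ≤ g (a + d) → ∃[ t ] f t ≡ g t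
discrete-IVT f g no-crossing a zero ga≤fa fa≤ga = a , ≤-antisym (subst (λ t → f t ≤ g t) (+-identityʳ a) fa≤ga) ga≤fa
discrete-IVT f g no-crossing a (suc d) ga≤fa fad≤gad with g a ≟ f a
... | yes ga≡fa = a , sym ga≡fa
... | no ga≢fa = discrete-IVT f g no-crossing (suc a) d (no-crossing a (≤∧≢⇒< ga≤fa ga≢fa))
                               (subst (λ t → f t ≤ g t) (+-suc a d) fad≤gad)

squeeze : ∀ {a b a′ b′} → a < b → a′ ≤ suc a → b ≤ suc b′ → b′ < a′ → a′ ≡ suc a × b ≡ suc b′ × b ≡ suc a
squeeze a<b a′≤1+a b≤1+b′ b′<a′ =
  ≤-antisym a′≤1+a (≤-trans a<b (≤-trans b≤1+b′ b′<a′)) ,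
  ≤-antisym b≤1+b′ (≤-trans b′<a′ (≤-trans a′≤1+a a<b)) ,
  ≤-antisym (≤-trans b≤1+b′ (≤-trans b′<a′ a′≤1+a)) a<b

parity-suc : ∀ n → parity (suc n) ≡ parity n ⁻¹
parity-suc n = trans (sym (⁻¹-involutive (parity (suc n)))) (cong _⁻¹ (suc-homo-⁻¹ n))

parity-suc≢ : ∀ n → parity (suc n) ≢ parity n
parity-suc≢ n e = p≢p⁻¹ (parity n) (sym (trans (sym (parity-suc n)) e))

InjectiveBelow : ∀ {A : Set} → ℕ → (ℕ → A) → Set
InjectiveBelow k c = ∀ i j → i < k → j < k → c i ≡ c j → i ≡ j

distinct : ∀ {A : Set} {k} {c : ℕ → A} → InjectiveBelow k c →
           ∀ i j {i<k : True (i <? k)} {j<k : True (j <? k)} → i ≢ j → c i ≢ c j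
distinct inj i j {i<k} {j<k} i≢j = i≢j ∘′ inj i j (toWitness i<k) (toWitness j<k)

extend : ∀ {A : Set} → (ℕ → A) → ℕ → A → ℕ → A
extend v r b t with t ≤? r
... | yes _ = v t
... | no _ = b

extend-≤ : ∀ {A : Set} (v : ℕ → A) r b {t} → t ≤ r → extend v r b t ≡ v t
extend-≤ v r b {t} t≤r with t ≤? r
... | yes _ = refl
... | no t≰r = contradiction t≤r t≰r

extend-suc : ∀ {A : Set} (v : ℕ → A) r b → extend v r b (suc r) ≡ b
extend-suc v r b with suc r ≤? r
... | yes r<r = contradiction r<r (<-irrefl refl)
... | no _ = refl

lookupOr : ∀ {A : Set} → A → List A → ℕ → A
lookupOr d xs t = fromMaybe d (head (drop t xs))

QRepeatingWalk⇒antipodal : ∀ {n} q {v : ℕ → Fin n} → QRepeatingWalk q (2 * q) v → ∃[ t ] t < q × v t ≡ v (t + q)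
QRepeatingWalk⇒antipodal q {v} (t , t′ , t<t′ , t′<2q , divides k t′∸t≡kq , vt≡vt′) with k
... | 0 = contradiction t′∸t≡kq (≢-sym (<⇒≢ (m<n⇒0<n∸m t<t′)))
... | 1 = t , t<q , subst (λ s → v t ≡ v s) t′≡t+q vt≡vt′
  where
    t′≡t+q : t′ ≡ t + q
    t′≡t+q = trans (sym (m+[n∸m]≡n (<⇒≤ t<t′))) (cong (t +_) (trans t′∸t≡kq (*-identityˡ q)))
    t<q : t < q
    t<q = +-cancelʳ-< q t q (subst₂ _<_ t′≡t+q (cong (q +_) (+-identityʳ q)) t′<2q)
... | suc (suc k) = contradiction t′<2q (≤⇒≯ (begin
      2 * q           ≤⟨ *-monoˡ-≤ q {2} {suc (suc k)} (s≤s (s≤s z≤n)) ⟩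
      suc (suc k) * q ≡⟨ t′∸t≡kq ⟨
      t′ ∸ t          ≤⟨ m∸n≤m t′ t ⟩
      t′              ∎))
  where open ≤-Reasoning

repeat-mod⇒QRepeatingWalk : ∀ {n} j q .{{_ : NonZero (suc (suc j) * q)}} {v : ℕ → Fin n} → 0 < q → ∀ T →
  v (T % (suc (suc j) * q)) ≡ v ((T + q) % (suc (suc j) * q)) → QRepeatingWalk q (suc (suc j) * q) v
repeat-mod⇒QRepeatingWalk j q {v} 0<q T vT≡vT+q = repeat-at (m%n<n T r) (trans vT≡vT+q (cong v ([m+n]%o≡[m%o+n]%o T q r)))
  where
    R r : ℕ
    R = suc j * q
    r = q + R
    0<R : 0 < R
    0<R = ≤-trans 0<q (m≤m+n q (j * q))
    repeat-at : ∀ {a} → a < r → v a ≡ v ((a + q) % r) → QRepeatingWalk q r v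
    repeat-at {a} a<r e with a + q <? r
    ... | yes a+q<r = a , a + q , m<m+n a 0<q , a+q<r , divides 1 (trans (m+n∸m≡n a q) (sym (*-identityˡ q))) ,
                      trans e (cong v (m<n⇒m%n≡m a+q<r))
    ... | no a+q≮r = b , a , b<a , a<r , divides (suc j) a∸b≡R , sym (trans e (cong v wrapped))
      where
        b : ℕ
        b = a + q ∸ r
        b+r≡a+q : b + r ≡ a + q
        b+r≡a+q = m∸n+n≡m (≮⇒≥ a+q≮r)
        b+R≡a : b + R ≡ a
        b+R≡a = +-cancelʳ-≡ q (b + R) a (trans (trans (+-assoc b R q) (cong (b +_) (+-comm R q))) b+r≡a+q)
        b<a : b < a
        b<a = subst (b <_) b+R≡a (m<m+n b 0<R)
        a∸b≡R : a ∸ b ≡ suc j * q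
        a∸b≡R = trans (cong (_∸ b) (sym b+R≡a)) (m+n∸m≡n b R)
        b<r : b < r
        b<r = +-cancelʳ-< r b r (subst (_< r + r) (sym b+r≡a+q) (+-mono-< a<r (m<m+n q 0<R)))
        wrapped : (a + q) % r ≡ b
        wrapped = trans (cong (_% r) (sym b+r≡a+q)) (trans ([m+n]%n≡m%n b r) (m<n⇒m%n≡m b<r))

-- Walks on a caterpillar seen from its spine

-- A step between vertices with leaf flags b, b′ and spine positions p, p′, where a leaf is placed at
-- the position of its neighbour.
data Move : Bool → Bool → ℕ → ℕ → Set where
  leave : ∀ {p} → Move true false p p
  enter : ∀ {p} → Move false true p p
  up    : ∀ {p} → Move false false p (suc p)
  down  : ∀ {p} → Move false false (suc p) p

-- The side of the vertex in the bipartition of the tree.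
tint : Bool → ℕ → Parity
tint true  p = parity (suc p)
tint false p = parity p

tint-step : ∀ {b b′ p p′} → Move b b′ p p′ → tint b′ p′ ≡ tint b p ⁻¹
tint-step {p = p} leave = sym (suc-homo-⁻¹ p)
tint-step {p = p} enter = parity-suc p
tint-step {p = p} up = parity-suc p
tint-step {p′ = p′} down = sym (suc-homo-⁻¹ p′)

tint-injective : ∀ {b b′} p → tint b p ≡ tint b′ p → b ≡ b′
tint-injective {true} {true} _ _ = refl
tint-injective {false} {false} _ _ = refl
tint-injective {true} {false} p e = contradiction e (parity-suc≢ p)
tint-injective {false} {true} p e = contradiction (sym e) (parity-suc≢ p)

Move-rise : ∀ {b b′ p} → Move b b′ p (suc p) → b ≡ false
Move-rise up = refl

Move-fall : ∀ {b b′ p} → Move b b′ (suc p) p → b ≡ false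
Move-fall down = refl

Move-≤ : ∀ {b b′ p p′} → Move b b′ p p′ → p′ ≤ suc p
Move-≤ leave = n≤1+n _
Move-≤ enter = n≤1+n _
Move-≤ up = ≤-refl
Move-≤ down = m≤n⇒m≤1+n (n≤1+n _)

Move-≥ : ∀ {b b′ p p′} → Move b b′ p p′ → p ≤ suc p′
Move-≥ leave = n≤1+n _
Move-≥ enter = n≤1+n _
Move-≥ up = m≤n⇒m≤1+n (n≤1+n _)
Move-≥ down = ≤-refl

module LazyWalk (L : ℕ → Bool) (P : ℕ → ℕ) (move : ∀ t → Move (L t) (L (suc t)) (P t) (P (suc t))) where

  colour : ℕ → Parity
  colour t = tint (L t) (P t)

  colour-+2* : ∀ t s → colour (t + 2 * s) ≡ colour t
  colour-+2* t zero = cong colour (+-identityʳ t)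
  colour-+2* t (suc s) = begin
    colour (t + 2 * suc s)         ≡⟨ cong colour (+-2*-suc t s) ⟩
    colour (suc (suc (t + 2 * s))) ≡⟨ tint-step (move (suc (t + 2 * s))) ⟩
    colour (suc (t + 2 * s)) ⁻¹    ≡⟨ cong _⁻¹ (tint-step (move (t + 2 * s))) ⟩
    colour (t + 2 * s) ⁻¹ ⁻¹       ≡⟨ ⁻¹-involutive _ ⟩
    colour (t + 2 * s)             ≡⟨ colour-+2* t s ⟩
    colour t                       ∎
    where open ≡-Reasoning

  -- P (t + 2k) - P t changes by at most 2 per step, and by 2 only if neither walk is at a leaf; but
  -- then it is even, both vertices having the same colour. So it cannot jump from -1 to 1.
  no-crossing : ∀ k t → P (t + 2 * k) < P t → P (suc t + 2 * k) ≤ P (suc t)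
  no-crossing k t below with P (suc t + 2 * k) ≤? P (suc t)
  ... | yes done = done
  ... | no ≰ with squeeze below (Move-≤ (move (t + 2 * k))) (Move-≥ (move t)) (≰⇒> ≰)
  ... | rise , fall , gap = contradiction (begin
    parity (suc (P (t + 2 * k))) ≡⟨ cong parity gap ⟨
    parity (P t)                 ≡⟨ cong (λ b → tint b (P t)) Lt≡false ⟨
    colour t                     ≡⟨ colour-+2* t k ⟨
    colour (t + 2 * k)           ≡⟨ cong (λ b → tint b (P (t + 2 * k))) Lt+2k≡false ⟩
    parity (P (t + 2 * k))       ∎) (parity-suc≢ (P (t + 2 * k)))
    where
      open ≡-Reasoning
      Lt≡false : L t ≡ false
      Lt≡false = Move-fall (subst (λ p → Move (L t) (L (suc t)) p (P (suc t))) fall (move t))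
      Lt+2k≡false : L (t + 2 * k) ≡ false
      Lt+2k≡false = Move-rise (subst (Move _ _ _) rise (move (t + 2 * k)))

  same-state : ∀ k R .{{_ : NonZero (2 * k + R)}} → (∀ t → P t ≡ P (t % (2 * k + R))) →
               ∃[ t ] P t ≡ P (t + 2 * k) × L t ≡ L (t + 2 * k)
  same-state k R periodic with discrete-IVT P (λ t → P (t + q)) (no-crossing k) s R (maximal (s + q)) behind
    where
      q r s : ℕ
      q = 2 * k
      r = q + R
      s = argmax P 0 (upTo r)
      maximal : ∀ t → P t ≤ P s
      maximal t = subst (_≤ P s) (sym (periodic t)) (All.lookup (f[xs]≤f[argmax] {f = P} 0 (upTo r)) (∈-upTo⁺ (m%n<n t r)))
      behind : P (s + R) ≤ P (s + R + q)
      behind = ≤-trans (maximal (s + R)) (≤-reflexive (begin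
        P s                ≡⟨ periodic s ⟩
        P (s % r)          ≡⟨ cong P ([m+n]%n≡m%n s r) ⟨
        P ((s + r) % r)    ≡⟨ cong (λ t → P (t % r)) (trans (+-assoc s R q) (cong (s +_) (+-comm R q))) ⟨
        P ((s + R + q) % r) ≡⟨ periodic _ ⟨
        P (s + R + q)      ∎))
        where open ≡-Reasoning
  ... | t , Pt≡Pt+q = t , Pt≡Pt+q , tint-injective (P t) (begin
    tint (L t) (P t)             ≡⟨ colour-+2* t k ⟨
    colour (t + 2 * k)           ≡⟨ cong (tint (L (t + 2 * k))) Pt≡Pt+q ⟨
    tint (L (t + 2 * k)) (P t)   ∎)
    where open ≡-Reasoning

module _ {n : ℕ} (G : Graph n) where

  neighbours : Fin n → Subset n
  neighbours v = tabulate (adj G v)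

  Adj⇒∈neighbours : ∀ {v w} → Adj G v w → w ∈ neighbours v
  Adj⇒∈neighbours {v} {w} vw = lookup⇒[]= w (neighbours v) (trans (lookup∘tabulate (adj G v) w) vw)

  ∈neighbours⇒Adj : ∀ {v w} → w ∈ neighbours v → Adj G v w
  ∈neighbours⇒Adj {v} {w} w∈ = trans (sym (lookup∘tabulate (adj G v) w)) ([]=⇒lookup w∈)

  Adj-sym : ∀ {v w} → Adj G v w → Adj G w v
  Adj-sym {v} {w} vw = trans (Graph.sym G w v) vw

  Adj-irrefl : ∀ {v} → ¬ Adj G v v
  Adj-irrefl {v} vv with trans (sym vv) (irrefl G v)
  ... | ()

  Adj? : ∀ v w → Dec (Adj G v w)
  Adj? v w = adj G v w ≟ᵇ true

  Leaf? : ∀ v → Dec (Leaf G v)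
  Leaf? v = degree G v ≟ 1

  Leaf⇒neighbour : ∀ {v} → Leaf G v → ∃[ w ] Adj G v w
  Leaf⇒neighbour leaf with ∣p∣≡1⇒nonempty leaf
  ... | w , w∈ = w , ∈neighbours⇒Adj w∈

  Leaf⇒unique-neighbour : ∀ {v w w′} → Leaf G v → Adj G v w → Adj G v w′ → w ≡ w′
  Leaf⇒unique-neighbour leaf vw vw′ = ∣p∣≡1⇒x≡y leaf (Adj⇒∈neighbours vw) (Adj⇒∈neighbours vw′)

  ¬Leaf⇒other-neighbour : ∀ {v w} → ¬ Leaf G v → Adj G v w → ∃[ w′ ] w′ ≢ w × Adj G v w′
  ¬Leaf⇒other-neighbour ¬leaf vw with x∈p∧∣p∣≢1⇒∃y≢x (Adj⇒∈neighbours vw) ¬leaf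
  ... | w′ , w′≢w , w′∈ = w′ , w′≢w , ∈neighbours⇒Adj w′∈

  Linked⇒IsWalk : ∀ d {x xs} → Linked (Adj G) (x ∷ xs) → IsWalk G (length xs) (lookupOr d (x ∷ xs))
  Linked⇒IsWalk d (xy ∷ _) zero _ = xy
  Linked⇒IsWalk d (_ ∷ linked) (suc i) (s≤s i<) = Linked⇒IsWalk d linked i i<

  QRepeating⇒antipodal : ∀ {q} → QRepeating G q → ∀ {v} → IsClosedWalk G (2 * q) v → ∃[ t ] t < q × v t ≡ v (t + q)
  QRepeating⇒antipodal {q} Q walk = QRepeatingWalk⇒antipodal q (Q 2 (s≤s (s≤s z≤n)) _ walk)

  periodic-walk : ∀ {r v} → IsClosedWalk G (suc r) v → ∀ m → IsWalk G m (λ t → v (t % suc r))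
  periodic-walk {r} {v} (walk , closed) _ t _ rewrite suc-%-suc t (suc r) ⦃ _ ⦄ with m%n<n t (suc r)
  ... | s≤s t%≤r with m≤n⇒m<n∨m≡n t%≤r
  ... | inj₁ t%<r rewrite m≤n⇒m%n≡m t%<r = walk (t % suc r) (s≤s t%≤r)
  ... | inj₂ t%≡r rewrite t%≡r | n%n≡0 (suc r) ⦃ _ ⦄ = subst (Adj G (v r)) closed (walk r ≤-refl)

  -- 6-repeating graphs are forests

  module _ (Q : QRepeating G 6) where

    ¬antipodally-distinct : ∀ {v} → IsClosedWalk G 12 v →
      v 0 ≢ v 6 → v 1 ≢ v 7 → v 2 ≢ v 8 → v 3 ≢ v 9 → v 4 ≢ v 10 → v 5 ≢ v 11 → ⊥
    ¬antipodally-distinct walk ≢₀ ≢₁ ≢₂ ≢₃ ≢₄ ≢₅ with QRepeating⇒antipodal Q walk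
    ... | 0 , _ , e = ≢₀ e
    ... | 1 , _ , e = ≢₁ e
    ... | 2 , _ , e = ≢₂ e
    ... | 3 , _ , e = ≢₃ e
    ... | 4 , _ , e = ≢₄ e
    ... | 5 , _ , e = ≢₅ e
    ... | suc (suc (suc (suc (suc (suc _))))) , s≤s (s≤s (s≤s (s≤s (s≤s (s≤s ()))))) , _

    ¬non-leaf-claw : ∀ {y a b c} → Adj G y a → Adj G y b → Adj G y c →
      ¬ Leaf G a → ¬ Leaf G b → ¬ Leaf G c → a ≢ b → a ≢ c → b ≢ c → ⊥
    ¬non-leaf-claw {y} ya yb yc ¬leafᵃ ¬leafᵇ ¬leafᶜ a≢b a≢c b≢c
      with ¬Leaf⇒other-neighbour ¬leafᵃ (Adj-sym ya)
         | ¬Leaf⇒other-neighbour ¬leafᵇ (Adj-sym yb)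
         | ¬Leaf⇒other-neighbour ¬leafᶜ (Adj-sym yc)
    ... | a′ , a′≢y , aa′ | b′ , b′≢y , bb′ | c′ , c′≢y , cc′ =
      ¬antipodally-distinct (Linked⇒IsWalk y (ya ∷ aa′ ∷ Adj-sym aa′ ∷ Adj-sym ya ∷ yb ∷ bb′ ∷ Adj-sym bb′ ∷ Adj-sym yb
                                            ∷ yc ∷ cc′ ∷ Adj-sym cc′ ∷ Adj-sym yc ∷ [-]) , refl)
        (≢-sym b′≢y) a≢b a′≢y a≢c (≢-sym c′≢y) b≢c

    -- The walk visits the positions 0,1,2,3,4,5,4,5,6,7,8,7 of the cycle.
    ¬cycle-route : ∀ {k c} → IsClosedWalk G (suc k) c → c (6 % suc k) ≡ c 0 →
      c 0 ≢ c (4 % suc k) → c (1 % suc k) ≢ c (5 % suc k) → c (2 % suc k) ≢ c (6 % suc k) →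
      c (3 % suc k) ≢ c (7 % suc k) → c (4 % suc k) ≢ c (8 % suc k) → c (5 % suc k) ≢ c (7 % suc k) → ⊥
    ¬cycle-route {k} {c} cycle closed =
      ¬antipodally-distinct
        (Linked⇒IsWalk (c 0) (edge 0 ∷ edge 1 ∷ edge 2 ∷ edge 3 ∷ edge 4 ∷ Adj-sym (edge 4)
                             ∷ edge 4 ∷ edge 5 ∷ edge 6 ∷ edge 7 ∷ Adj-sym (edge 7) ∷ Adj-sym (edge 6) ∷ [-]) , closed)
      where
        edge : ∀ i → Adj G (c (i % suc k)) (c (suc i % suc k))
        edge i = periodic-walk cycle (suc i) i ≤-refl

    ¬triangle : ∀ {c} → IsClosedWalk G 3 c → InjectiveBelow 3 c → ⊥
    ¬triangle cycle inj = ¬cycle-route cycle refl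
      (distinct inj 0 1 λ ()) (distinct inj 1 2 λ ()) (distinct inj 2 0 λ ())
      (distinct inj 0 1 λ ()) (distinct inj 1 2 λ ()) (distinct inj 2 1 λ ())

    ¬hexagon : ∀ {c} → IsClosedWalk G 6 c → InjectiveBelow 6 c → ⊥
    ¬hexagon cycle inj = ¬cycle-route cycle refl
      (distinct inj 0 4 λ ()) (distinct inj 1 5 λ ()) (distinct inj 2 0 λ ())
      (distinct inj 3 1 λ ()) (distinct inj 4 2 λ ()) (distinct inj 5 1 λ ())

    -- Going around a k-cycle for lcm(6,k) steps: a 6-repetition would be at a distance divisible by
    -- both 6 and k, hence by lcm(6,k).
    ¬cycle-∤6 : ∀ {k c} → IsClosedWalk G (suc k) c → InjectiveBelow (suc k) c → ¬ (suc k ∣ 6) → ⊥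
    ¬cycle-∤6 {k} {c} cycle inj k∤6 with m∣lcm[m,n] 6 (suc k)
    ... | divides 0 L≡0 = lcm-suc≢0 5 k L≡0
    ... | divides 1 L≡6 = k∤6 (subst (suc k ∣_) L≡6 (n∣lcm[m,n] 6 (suc k)))
    ... | divides (suc (suc j)) L≡j*6
      with Q (suc (suc j)) (s≤s (s≤s z≤n)) (λ t → c (t % suc k)) (periodic-walk cycle _ , closed)
      where
        closed : c (suc (suc j) * 6 % suc k) ≡ c 0
        closed = cong c (n∣m⇒m%n≡0 _ (suc k) (subst (suc k ∣_) L≡j*6 (n∣lcm[m,n] 6 (suc k))))
    ... | t , t′ , t<t′ , t′<L , 6∣t′∸t , ct≡ct′ = contradiction t′<L (≤⇒≯ (begin
        suc (suc j) * 6 ≡⟨ L≡j*6 ⟨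
        lcm 6 (suc k)   ≤⟨ ∣⇒≤ ⦃ >-nonZero (m<n⇒0<n∸m t<t′) ⦄ (lcm-least 6∣t′∸t k∣t′∸t) ⟩
        t′ ∸ t          ≤⟨ m∸n≤m t′ t ⟩
        t′              ∎))
      where
        open ≤-Reasoning
        k∣t′∸t : suc k ∣ t′ ∸ t
        k∣t′∸t = %-≡⇒∣∸ t t′ (suc k) (inj _ _ (m%n<n t (suc k)) (m%n<n t′ (suc k)) ct≡ct′)

    6-repeating⇒forest : Forest G
    6-repeating⇒forest (zero , _ , () , _)
    6-repeating⇒forest (suc k , c , 3≤k , cycle , inj) with suc k ∣? 6
    ... | no k∤6 = ¬cycle-∤6 cycle inj k∤6
    ... | yes k∣6 with 3≤∣6⇒3∨6 3≤k k∣6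
    ... | inj₁ refl = ¬triangle cycle inj
    ... | inj₂ refl = ¬hexagon cycle inj

  -- Spines of 6-repeating graphs are paths

  IsWalk-extend : ∀ {r v b} → IsWalk G r v → Adj G (v r) b → IsWalk G (suc r) (extend v r b)
  IsWalk-extend {r} {v} {b} walk vb i (s≤s i≤r) with m≤n⇒m<n∨m≡n i≤r
  ... | inj₁ i<r rewrite extend-≤ v r b i≤r | extend-≤ v r b i<r = walk i i<r
  ... | inj₂ refl rewrite extend-≤ v i b i≤r | extend-suc v i b = vb

  Connected-refl : ∀ x → Connected G x x
  Connected-refl x = 0 , (λ _ → x) , (λ _ ()) , refl , refl

  Connected-step : ∀ {x a b} → Connected G x a → Adj G a b → Connected G x b
  Connected-step {b = b} (r , v , walk , v₀≡x , vᵣ≡a) ab =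
    suc r , extend v r b , IsWalk-extend walk (subst (λ a → Adj G a b) (sym vᵣ≡a) ab) ,
    trans (extend-≤ v r b z≤n) v₀≡x , extend-suc v r b

  Connected-closed : ∀ (C : Fin n → Set) → (∀ {a b} → C a → Adj G a b → C b) → ∀ {x y} → C x → Connected G x y → C y
  Connected-closed C step {y = y} Cx (r , v , walk , v₀≡x , vᵣ≡y) = subst C vᵣ≡y (along r ≤-refl)
    where
      along : ∀ t → t ≤ r → C (v t)
      along zero _ = subst C (sym v₀≡x) Cx
      along (suc t) t<r = step (along t (<⇒≤ t<r)) (walk t t<r)

  Spine : Fin n → Fin n → Set
  Spine x y = Connected G x y × ¬ Leaf G y

  module _ (x : Fin n) where

    record SpinePath : Set where
      field
        len          : ℕ
        at           : ℕ → Fin n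
        at-injective : ∀ i j → i ≤ len → j ≤ len → at i ≡ at j → i ≡ j
        at-adjacent  : ∀ i → i < len → Adj G (at i) (at (suc i))
        at-spine     : ∀ i → i ≤ len → Spine x (at i)

    open SpinePath

    OnPath : SpinePath → Fin n → Set
    OnPath P z = ∃[ i ] i ≤ len P × at P i ≡ z

    OnPath? : ∀ P z → Dec (OnPath P z)
    OnPath? P z = map′ (λ (i , i<1+len , e) → i , ≤-pred i<1+len , e) (λ (i , i≤len , e) → i , s≤s i≤len , e)
                       (anyUpTo? (λ i → at P i ≟ᶠ z) (suc (len P)))

    StuckAtStart StuckAtEnd : SpinePath → Set
    StuckAtStart P = ∀ z → Adj G (at P 0) z → ¬ Leaf G z → OnPath P z
    StuckAtEnd P = ∀ z → Adj G (at P (len P)) z → ¬ Leaf G z → OnPath P z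

    _⊆ᵖ_ : SpinePath → SpinePath → Set
    P ⊆ᵖ P′ = ∀ z → OnPath P z → OnPath P′ z

    singleton : ∀ {s} → Spine x s → SpinePath
    singleton {s} s∈ = record
      { len = 0 ; at = λ _ → s
      ; at-injective = λ _ _ i≤0 j≤0 _ → trans (n≤0⇒n≡0 i≤0) (sym (n≤0⇒n≡0 j≤0))
      ; at-adjacent = λ _ ()
      ; at-spine = λ _ _ → s∈ }

    cons : (P : SpinePath) → ∀ {z} → Adj G (at P 0) z → ¬ Leaf G z → ¬ OnPath P z → SpinePath
    cons P {z} az ¬leaf ∉P = record { len = suc (len P) ; at = at′ ; at-injective = inj′ ; at-adjacent = adj′ ; at-spine = spine′ }
      where
        at′ : ℕ → Fin n
        at′ 0 = z
        at′ (suc i) = at P i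
        inj′ : ∀ i j → i ≤ suc (len P) → j ≤ suc (len P) → at′ i ≡ at′ j → i ≡ j
        inj′ 0 0 _ _ _ = refl
        inj′ 0 (suc j) _ (s≤s j≤) e = contradiction (j , j≤ , sym e) ∉P
        inj′ (suc i) 0 (s≤s i≤) _ e = contradiction (i , i≤ , e) ∉P
        inj′ (suc i) (suc j) (s≤s i≤) (s≤s j≤) e = cong suc (at-injective P i j i≤ j≤ e)
        adj′ : ∀ i → i < suc (len P) → Adj G (at′ i) (at′ (suc i))
        adj′ 0 _ = Adj-sym az
        adj′ (suc i) (s≤s i<) = at-adjacent P i i<
        spine′ : ∀ i → i ≤ suc (len P) → Spine x (at′ i)
        spine′ 0 _ = Connected-step (proj₁ (at-spine P 0 z≤n)) az , ¬leaf
        spine′ (suc i) (s≤s i≤) = at-spine P i i≤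

    reverse : SpinePath → SpinePath
    reverse P = record
      { len = len P ; at = λ i → at P (len P ∸ i)
      ; at-injective = inj′ ; at-adjacent = adj′
      ; at-spine = λ i _ → at-spine P (len P ∸ i) (m∸n≤m _ i) }
      where
        inj′ : ∀ i j → i ≤ len P → j ≤ len P → at P (len P ∸ i) ≡ at P (len P ∸ j) → i ≡ j
        inj′ i j i≤ j≤ e = begin
          i                   ≡⟨ m∸[m∸n]≡n i≤ ⟨
          len P ∸ (len P ∸ i) ≡⟨ cong (len P ∸_) (at-injective P _ _ (m∸n≤m _ i) (m∸n≤m _ j) e) ⟩
          len P ∸ (len P ∸ j) ≡⟨ m∸[m∸n]≡n j≤ ⟩
          j                   ∎
          where open ≡-Reasoning
        adj′ : ∀ i → i < len P → Adj G (at P (len P ∸ i)) (at P (len P ∸ suc i))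
        adj′ i i<len rewrite +-∸-assoc 1 i<len = Adj-sym (at-adjacent P (len P ∸ suc i) (subst (_≤ len P) (+-∸-assoc 1 i<len) (m∸n≤m (len P) i)))

    OnPath-reverse : ∀ P {z} → OnPath P z → OnPath (reverse P) z
    OnPath-reverse P (i , i≤ , e) = len P ∸ i , m∸n≤m _ i , trans (cong (at P) (m∸[m∸n]≡n i≤)) e

    StuckAtStart⇒StuckAtEnd-reverse : ∀ P → StuckAtStart P → StuckAtEnd (reverse P)
    StuckAtStart⇒StuckAtEnd-reverse P stuck z az ¬leaf =
      OnPath-reverse P (stuck z (subst (λ i → Adj G (at P i) z) (n∸n≡0 (len P)) az) ¬leaf)

    grow-at-start : ∀ fuel P → n ≤ len P + fuel →
                   Σ SpinePath λ P′ → StuckAtStart P′ × at P′ (len P′) ≡ at P (len P) × P ⊆ᵖ P′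
    grow-at-start zero P n≤len = contradiction (pigeonhole (s≤s (subst (n ≤_) (+-identityʳ (len P)) n≤len)) (at P ∘′ toℕ)) ¬repeat
      where
        ¬repeat : ¬ ∃₂ λ i j → i <ᶠ j × at P (toℕ i) ≡ at P (toℕ j)
        ¬repeat (i , j , i<j , e) = <-irrefl (at-injective P _ _ (≤-pred (toℕ<n i)) (≤-pred (toℕ<n j)) e) i<j
    grow-at-start (suc fuel) P n≤ with any? (λ z → Adj? (at P 0) z ×-dec ¬? (Leaf? z) ×-dec ¬? (OnPath? P z))
    ... | yes (z , az , ¬leaf , ∉P) with grow-at-start fuel (cons P az ¬leaf ∉P) (subst (n ≤_) (+-suc (len P) fuel) n≤)
    ...   | P′ , stuck , last , ⊆P′ = P′ , stuck , last , λ w (i , i≤ , e) → ⊆P′ w (suc i , s≤s i≤ , e)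
    grow-at-start (suc fuel) P n≤ | no ∄z = P , stuck , refl , λ _ on → on
      where
        stuck : StuckAtStart P
        stuck z az ¬leaf = decidable-stable (OnPath? P z) λ ∉P → ∄z (z , az , ¬leaf , ∉P)

    maximal-path : ∀ P → Σ SpinePath λ P′ → StuckAtStart P′ × StuckAtEnd P′ × P ⊆ᵖ P′
    maximal-path P with grow-at-start n P (m≤n+m n (len P))
    ... | P₁ , stuck₁ , _ , P⊆P₁ with grow-at-start n (reverse P₁) (m≤n+m n (len P₁))
    ... | P₂ , stuck₂ , last , P₁ʳ⊆P₂ = P₂ , stuck₂ , stuck-end , λ z on → P₁ʳ⊆P₂ z (OnPath-reverse P₁ (P⊆P₁ z on))
      where
        stuck-end : StuckAtEnd P₂
        stuck-end z az ¬leaf = P₁ʳ⊆P₂ z (StuckAtStart⇒StuckAtEnd-reverse P₁ stuck₁ z (subst (λ w → Adj G w z) last az) ¬leaf)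

    chord⇒cycle : ∀ P a d → 2 ≤ d → a + d ≤ len P → Adj G (at P a) (at P (a + d)) → HasCycle G
    chord⇒cycle P a d 2≤d a+d≤len chord = suc d , c , s≤s 2≤d , (walk , closed) , injective
      where
        arc : ℕ → Fin n
        arc l = at P (a + l)
        c : ℕ → Fin n
        c = extend arc d (at P a)
        arc-adjacent : IsWalk G d arc
        arc-adjacent l l<d = subst (λ k → Adj G (arc l) (at P k)) (sym (+-suc a l))
                               (at-adjacent P (a + l) (≤-trans (+-monoʳ-< a l<d) a+d≤len))
        walk : IsWalk G (suc d) c
        walk = IsWalk-extend arc-adjacent (Adj-sym chord)
        closed : c (suc d) ≡ c 0
        closed = trans (extend-suc arc d (at P a)) (trans (cong (at P) (sym (+-identityʳ a))) (sym (extend-≤ arc d (at P a) z≤n)))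
        bound : ∀ {i} → i ≤ d → a + i ≤ len P
        bound i≤d = ≤-trans (+-monoʳ-≤ a i≤d) a+d≤len
        injective : ∀ i j → i < suc d → j < suc d → c i ≡ c j → i ≡ j
        injective i j (s≤s i≤d) (s≤s j≤d) e rewrite extend-≤ arc d (at P a) i≤d | extend-≤ arc d (at P a) j≤d =
          +-cancelˡ-≡ a i j (at-injective P (a + i) (a + j) (bound i≤d) (bound j≤d) e)

    Forest⇒consecutive : Forest G → ∀ P {i j} → i < j → j ≤ len P → Adj G (at P i) (at P j) → j ≡ suc i
    Forest⇒consecutive forest P {i} {j} i<j j≤len chord with m≤n⇒m<n∨m≡n i<j
    ... | inj₂ 1+i≡j = sym 1+i≡j
    ... | inj₁ 1+i<j = contradiction (chord⇒cycle P i (j ∸ i) 2≤j∸i (subst (_≤ len P) (sym i+[j∸i]≡j) j≤len)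
                                        (subst (λ k → Adj G (at P i) (at P k)) (sym i+[j∸i]≡j) chord)) forest
      where
        i+[j∸i]≡j : i + (j ∸ i) ≡ j
        i+[j∸i]≡j = m+[n∸m]≡n (<⇒≤ i<j)
        2≤j∸i : 2 ≤ j ∸ i
        2≤j∸i = subst (_≤ j ∸ i) (m+n∸n≡m 2 i) (∸-monoˡ-≤ i 1+i<j)

    Covered : SpinePath → Fin n → Set
    Covered P z = OnPath P z ⊎ (Leaf G z × ∃[ w ] OnPath P w × Adj G z w)

    Covered-⊆ᵖ : ∀ {P P′ z} → P ⊆ᵖ P′ → Covered P z → Covered P′ z
    Covered-⊆ᵖ P⊆P′ (inj₁ on) = inj₁ (P⊆P′ _ on)
    Covered-⊆ᵖ P⊆P′ (inj₂ (leaf , w , on , zw)) = inj₂ (leaf , w , P⊆P′ w on , zw)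

    module _ (Q : QRepeating G 6) (P : SpinePath) (stuckˢ : StuckAtStart P) (stuckᵉ : StuckAtEnd P) where

      non-leaf-neighbour⇒OnPath : ∀ i {z} → i ≤ len P → Adj G (at P i) z → ¬ Leaf G z → OnPath P z
      non-leaf-neighbour⇒OnPath 0 _ az ¬leaf = stuckˢ _ az ¬leaf
      non-leaf-neighbour⇒OnPath (suc i) {z} 1+i≤len az ¬leaf with m≤n⇒m<n∨m≡n 1+i≤len | OnPath? P z
      ... | inj₂ refl | _ = stuckᵉ z az ¬leaf
      ... | inj₁ _ | yes on = on
      ... | inj₁ 1+i<len | no ∉P = ⊥-elim (
        ¬non-leaf-claw Q (Adj-sym (at-adjacent P i 1+i≤len)) (at-adjacent P (suc i) 1+i<len) az
          (proj₂ (at-spine P i i≤len)) (proj₂ (at-spine P (suc (suc i)) 1+i<len)) ¬leaf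
          (λ e → <-irrefl (at-injective P i (suc (suc i)) i≤len 1+i<len e) (m<n⇒m<1+n (n<1+n i)))
          (λ e → ∉P (i , i≤len , e)) (λ e → ∉P (suc (suc i) , 1+i<len , e)))
        where
          i≤len : i ≤ len P
          i≤len = <⇒≤ 1+i≤len

      Covered-step : ∀ {z z′} → Covered P z → Adj G z z′ → Covered P z′
      Covered-step (inj₂ (leaf , w , on , zw)) zz′ = inj₁ (subst (OnPath P) (Leaf⇒unique-neighbour leaf zw zz′) on)
      Covered-step {z} {z′} (inj₁ (i , i≤len , atᵢ≡z)) zz′ with Leaf? z′
      ... | yes leaf = inj₂ (leaf , z , (i , i≤len , atᵢ≡z) , Adj-sym zz′)
      ... | no ¬leaf = inj₁ (non-leaf-neighbour⇒OnPath i i≤len (subst (λ w → Adj G w z′) (sym atᵢ≡z) zz′) ¬leaf)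

      maximal-Covered⇒InducesPath : Covered P x → InducesPath G (Spine x)
      maximal-Covered⇒InducesPath cov =
        suc (len P) , u , u-injective , (λ y → mk⇔ (∈⇒image y) (image⇒∈ y)) , λ i j → mk⇔ (adj⇒consecutive i j) (consecutive⇒adj i j)
        where
          u : Fin (suc (len P)) → Fin n
          u i = at P (toℕ i)
          bound : ∀ (i : Fin (suc (len P))) → toℕ i ≤ len P
          bound i = ≤-pred (toℕ<n i)
          u-injective : ∀ {i j} → u i ≡ u j → i ≡ j
          u-injective {i} {j} e = toℕ-injective (at-injective P _ _ (bound i) (bound j) e)
          ∈⇒image : ∀ y → Spine x y → ∃[ i ] u i ≡ y
          ∈⇒image y (x⇝y , ¬leaf) with Connected-closed (Covered P) Covered-step cov x⇝y
          ... | inj₁ (i , i≤len , e) = fromℕ< (s≤s i≤len) , trans (cong (at P) (toℕ-fromℕ< (s≤s i≤len))) e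
          ... | inj₂ (leaf , _) = contradiction leaf ¬leaf
          image⇒∈ : ∀ y → ∃[ i ] u i ≡ y → Spine x y
          image⇒∈ y (i , e) = subst (Spine x) e (at-spine P (toℕ i) (bound i))
          forest : Forest G
          forest = 6-repeating⇒forest Q
          adj⇒consecutive : ∀ i j → Adj G (u i) (u j) → toℕ j ≡ suc (toℕ i) ⊎ toℕ i ≡ suc (toℕ j)
          adj⇒consecutive i j uv with <-cmp (toℕ i) (toℕ j)
          ... | tri< i<j _ _ = inj₁ (Forest⇒consecutive forest P i<j (bound j) uv)
          ... | tri≈ _ i≡j _ = contradiction (subst (λ k → Adj G (u i) (at P k)) (sym i≡j) uv) Adj-irrefl
          ... | tri> _ _ j<i = inj₂ (Forest⇒consecutive forest P j<i (bound i) (Adj-sym uv))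
          consecutive⇒adj : ∀ i j → toℕ j ≡ suc (toℕ i) ⊎ toℕ i ≡ suc (toℕ j) → Adj G (u i) (u j)
          consecutive⇒adj i j (inj₁ j≡1+i) =
            subst (λ k → Adj G (u i) (at P k)) (sym j≡1+i) (at-adjacent P (toℕ i) (subst (_≤ len P) j≡1+i (bound j)))
          consecutive⇒adj i j (inj₂ i≡1+j) =
            Adj-sym (subst (λ k → Adj G (u j) (at P k)) (sym i≡1+j) (at-adjacent P (toℕ j) (subst (_≤ len P) i≡1+j (bound i))))

    Covered⇒InducesPath : QRepeating G 6 → ∀ P → Covered P x → InducesPath G (Spine x)
    Covered⇒InducesPath Q P cov with maximal-path P
    ... | P′ , stuckˢ , stuckᵉ , P⊆P′ = maximal-Covered⇒InducesPath Q P′ stuckˢ stuckᵉ (Covered-⊆ᵖ {P} {P′} P⊆P′ cov)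

    leaf-edge⇒InducesPath : ∀ {z} → Leaf G x → Leaf G z → Adj G x z → InducesPath G (Spine x)
    leaf-edge⇒InducesPath {z} leafˣ leafᶻ xz = 0 , none , (λ { {()} }) , (λ y → mk⇔ (∉Spine y) λ { (() , _) }) , λ ()
      where
        none : Fin 0 → Fin n
        none ()
        step : ∀ {a b} → a ≡ x ⊎ a ≡ z → Adj G a b → b ≡ x ⊎ b ≡ z
        step (inj₁ refl) ab = inj₂ (Leaf⇒unique-neighbour leafˣ ab xz)
        step (inj₂ refl) ab = inj₁ (Leaf⇒unique-neighbour leafᶻ ab (Adj-sym xz))
        ∉Spine : ∀ y → Spine x y → ∃[ i ] none i ≡ y
        ∉Spine y (x⇝y , ¬leaf) with Connected-closed (λ w → w ≡ x ⊎ w ≡ z) step (inj₁ refl) x⇝y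
        ... | inj₁ refl = contradiction leafˣ ¬leaf
        ... | inj₂ refl = contradiction leafᶻ ¬leaf

    6-repeating⇒InducesPath : QRepeating G 6 → InducesPath G (Spine x)
    6-repeating⇒InducesPath Q with Leaf? x
    ... | no ¬leaf = Covered⇒InducesPath Q (singleton (Connected-refl x , ¬leaf)) (inj₁ (0 , z≤n , refl))
    ... | yes leaf with Leaf⇒neighbour leaf
    ... | z , xz with Leaf? z
    ... | no ¬leafᶻ = Covered⇒InducesPath Q (singleton (Connected-step (Connected-refl x) xz , ¬leafᶻ))
                                                (inj₂ (leaf , z , (0 , z≤n , refl) , xz))
    ... | yes leafᶻ = leaf-edge⇒InducesPath leaf leafᶻ xz

  -- Caterpillar forests are repeating

  leaf-pair⇒2-periodic : ∀ {w : ℕ → Fin n} → (∀ t → Adj G (w t) (w (suc t))) → ∀ {t} → Leaf G (w t) → Leaf G (w (suc t)) →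
                         ∀ s → w (t + 2 * s) ≡ w t × w (suc (t + 2 * s)) ≡ w (suc t)
  leaf-pair⇒2-periodic {w} adjacent {t} leaf leaf′ zero = cong w (+-identityʳ t) , cong (w ∘′ suc) (+-identityʳ t)
  leaf-pair⇒2-periodic {w} adjacent {t} leaf leaf′ (suc s) with leaf-pair⇒2-periodic adjacent leaf leaf′ s
  ... | wT≡wt , w1+T≡w1+t = subst (λ k → w k ≡ w t) (sym (+-2*-suc t s)) w2+T≡wt ,
                            subst (λ k → w (suc k) ≡ w (suc t)) (sym (+-2*-suc t s)) w3+T≡w1+t
    where
      T : ℕ
      T = t + 2 * s
      w2+T≡wt : w (suc (suc T)) ≡ w t
      w2+T≡wt = trans (Leaf⇒unique-neighbour (subst (Leaf G) (sym w1+T≡w1+t) leaf′) (adjacent (suc T)) (Adj-sym (adjacent T))) wT≡wt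
      w3+T≡w1+t : w (suc (suc (suc T))) ≡ w (suc t)
      w3+T≡w1+t = trans (Leaf⇒unique-neighbour (subst (Leaf G) (sym w2+T≡wt) leaf) (adjacent (suc (suc T))) (Adj-sym (adjacent (suc T)))) w1+T≡w1+t

  module _ (spine : ∀ x → InducesPath G (Spine x)) (m j : ℕ) {v : ℕ → Fin n}
           (closed-walk : IsClosedWalk G (suc (suc j) * (2 * suc m)) v) where

    private
      q r : ℕ
      q = 2 * suc m
      r = suc (suc j) * q

      w : ℕ → Fin n
      w t = v (t % r)

      w-adjacent : ∀ t → Adj G (w t) (w (suc t))
      w-adjacent t = periodic-walk closed-walk (suc t) t ≤-refl

      wrap : ∀ T → w T ≡ w (T + q) → QRepeatingWalk q r v
      wrap = repeat-mod⇒QRepeatingWalk j q (s≤s z≤n)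

      w-connected : ∀ t → Connected G (v 0) (w t)
      w-connected t = t % r , v , (λ i i< → proj₁ closed-walk i (<-trans i< (m%n<n t r))) , refl , refl

    module _ {M} (u : Fin M → Fin n) (u-injective : ∀ {a b} → u a ≡ u b → a ≡ b)
             (index : ∀ y → Spine (v 0) y → ∃[ a ] u a ≡ y)
             (u-adjacent : ∀ a b → Adj G (u a) (u b) → toℕ b ≡ suc (toℕ a) ⊎ toℕ a ≡ suc (toℕ b))
             (no-leaf-pair : ∀ t → Leaf G (w t) → ¬ Leaf G (w (suc t))) where

      Anchored : ℕ → Bool → Fin M → Set
      Anchored t true  a = Leaf G (w t) × u a ≡ w (suc t)
      Anchored t false a = ¬ Leaf G (w t) × u a ≡ w t

      anchor : ∀ t → Σ Bool λ b → Σ (Fin M) (Anchored t b)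
      anchor t with Leaf? (w t)
      ... | yes leaf = let a , e = index (w (suc t)) (w-connected (suc t) , no-leaf-pair t leaf) in true , a , leaf , e
      ... | no ¬leaf = let a , e = index (w t) (w-connected t , ¬leaf) in false , a , ¬leaf , e

      L : ℕ → Bool
      L t = proj₁ (anchor t)

      I : ℕ → Fin M
      I t = proj₁ (proj₂ (anchor t))

      anchored : ∀ t → Anchored t (L t) (I t)
      anchored t = proj₂ (proj₂ (anchor t))

      anchored-unique : ∀ {t t′ b b′ a a′} → Anchored t b a → Anchored t′ b′ a′ →
                        w t ≡ w t′ → w (suc t) ≡ w (suc t′) → a ≡ a′
      anchored-unique {b = true}  {true}  (_ , e) (_ , e′) _ w1+t≡ = u-injective (trans e (trans w1+t≡ (sym e′)))
      anchored-unique {b = false} {false} (_ , e) (_ , e′) wt≡ _ = u-injective (trans e (trans wt≡ (sym e′)))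
      anchored-unique {b = true}  {false} (leaf , _) (¬leaf , _) wt≡ _ = contradiction (subst (Leaf G) wt≡ leaf) ¬leaf
      anchored-unique {b = false} {true}  (¬leaf , _) (leaf , _) wt≡ _ = contradiction (subst (Leaf G) (sym wt≡) leaf) ¬leaf

      anchored-move : ∀ {t b b′ a a′} → Anchored t b a → Anchored (suc t) b′ a′ → Move b b′ (toℕ a) (toℕ a′)
      anchored-move {t} {true}  {true}  (leaf , _) (leaf′ , _) = ⊥-elim (no-leaf-pair t leaf leaf′)
      anchored-move {t} {true}  {false} (_ , e) (_ , e′) =
        subst (Move true false _) (cong toℕ (u-injective (trans e (sym e′)))) leave
      anchored-move {t} {false} {true}  (_ , e) (leaf′ , e′) =
        subst (Move false true _) (cong toℕ (u-injective (trans e (sym (trans e′ bounce))))) enter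
        where
          bounce : w (suc (suc t)) ≡ w t
          bounce = Leaf⇒unique-neighbour leaf′ (w-adjacent (suc t)) (Adj-sym (w-adjacent t))
      anchored-move {t} {false} {false} (_ , e) (_ , e′) with u-adjacent _ _ (subst₂ (Adj G) (sym e) (sym e′) (w-adjacent t))
      ... | inj₁ rise = subst (Move false false _) (sym rise) up
      ... | inj₂ fall = subst (λ p → Move false false p _) (sym fall) down

      same-anchor : ∀ {t t′ b a} → Anchored t b a → Anchored t′ b a → w t ≡ w t′ ⊎ w (suc t) ≡ w (suc t′)
      same-anchor {b = true}  (_ , e) (_ , e′) = inj₂ (trans (sym e) e′)
      same-anchor {b = false} (_ , e) (_ , e′) = inj₁ (trans (sym e) e′)

      open LazyWalk L (toℕ ∘′ I) (λ t → anchored-move (anchored t) (anchored (suc t)))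

      anchor-periodic : ∀ t → toℕ (I t) ≡ toℕ (I (t % r))
      anchor-periodic t = cong toℕ (anchored-unique (anchored t) (anchored (t % r))
                                      (cong v (sym (m%n%n≡m%n t r))) (cong v (suc-%-suc t r)))

      no-leaf-pair⇒QRepeatingWalk : QRepeatingWalk q r v
      no-leaf-pair⇒QRepeatingWalk =
        let t , It≡ , Lt≡ = same-state (suc m) (suc j * q) anchor-periodic
        in [ wrap t , wrap (suc t) ]′
             (same-anchor (anchored t) (subst₂ (Anchored (t + q)) (sym Lt≡) (sym (toℕ-injective It≡)) (anchored (t + q))))

    caterpillar-walk⇒QRepeatingWalk : QRepeatingWalk q r v
    caterpillar-walk⇒QRepeatingWalk with anyUpTo? (λ t → Leaf? (w t) ×-dec Leaf? (w (suc t))) r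
    ... | yes (t , _ , leaf , leaf′) = wrap t (sym (proj₁ (leaf-pair⇒2-periodic w-adjacent leaf leaf′ (suc m))))
    ... | no ∄leaf-pair with spine (v 0)
    ... | _ , u , u-injective , membership , adjacency =
      no-leaf-pair⇒QRepeatingWalk u u-injective (λ y → Equivalence.to (membership y)) (λ a b → Equivalence.to (adjacency a b)) no-leaf-pair
      where
        no-leaf-pair : ∀ t → Leaf G (w t) → ¬ Leaf G (w (suc t))
        no-leaf-pair t leaf leaf′ = ∄leaf-pair (t % r , m%n<n t r , subst (Leaf G) (cong v (sym (m%n%n≡m%n t r))) leaf ,
                                                subst (Leaf G) (cong v (suc-%-suc t r)) leaf′)

  spine-paths⇒Repeating : (∀ x → InducesPath G (Spine x)) → Repeating G
  spine-paths⇒Repeating spine m (suc (suc j)) _ _ closed-walk = caterpillar-walk⇒QRepeatingWalk spine m j closed-walk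
  spine-paths⇒Repeating spine m 1 (s≤s ())

  CaterpillarForest⇒Repeating : CaterpillarForest G → Repeating G
  CaterpillarForest⇒Repeating (_ , spine) = spine-paths⇒Repeating spine

  6-repeating⇒CaterpillarForest : QRepeating G 6 → CaterpillarForest G
  6-repeating⇒CaterpillarForest Q = 6-repeating⇒forest Q , λ x → 6-repeating⇒InducesPath x Q

proposition10 : ∀ {n : ℕ} (G : Graph n) →
    (CaterpillarForest G ⇔ Repeating G) × (Repeating G ⇔ QRepeating G 6)
proposition10 G =
  mk⇔ (CaterpillarForest⇒Repeating G) (6-repeating⇒CaterpillarForest G ∘′ 6-repeating) ,
  mk⇔ 6-repeating (CaterpillarForest⇒Repeating G ∘′ 6-repeating⇒CaterpillarForest G)
  where
    6-repeating : Repeating G → QRepeating G 6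
    6-repeating repeating = repeating 2
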